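{- Let $G_1$ and $G_2$ be groups whose orders are even powers of $2$, and suppose $G_2$ is generated by $\{x_1, x_2, \ldots, x_n\}$. Let $D_1$ and $D_2$ be symplectic difference sets in $G_1$ and $G_2$, respectively, and let $\phi : G_2 \to \mathrm{Aut}(G_1)$ be a homomorphism, writing $\phi_g = \phi(g)$. If $\phi_{x_i}(D_1) = D_1$ for all $i = 1, \ldots, n$, then \[D = \big(D_1 \times (G_2 - D_2)\big) \cup \big((G_1 - D_1) \times D_2\big)\] is a symplectic difference set in $G_1 \rtimes_\phi G_2$.
   Context: A $(v,k,\lambda)$ difference set in a group $G$ of order $v$ is a subset $D$ of size $k$ such that the multiset $\{d_1 d_2^{ -1} : d_1,d_2 \in D\}$ contains every non-identity element of $G$ exactly $\lambda$ times. Its development is the symmetric design with points the elements of $G$, blocks the left translates $gD$ ($g\in G$), incidence by membership. Two symmetric designs with incidence matrices $A_1, A_2$ are isomorphic iff $A_1 = P A_2 Q$ for some permutation matrices $P, Q$. The symplectic design on $2^{2m}$ points is the design with incidence matrix $A = -\tfrac12\big((J_4 - 2I_4)^{\otimes m} - J\big)$, where $\otimes$ is the Kronecker product, $I_4$, $J_4$ are the $4\times 4$ identity and all-ones matrices and $J$ is the $4^m \times 4^m$ all-ones matrix. A symplectic difference set is a difference set (in a group of order $2^{2m}$) whose development is isomorphic to the symplectic design on $2^{2m}$ points. For a homomorphism $\phi: H \to \mathrm{Aut}(N)$, the semi-direct product $N \rtimes_\phi H$ has underlying set $N \times H$ and multiplication $(n_1,h_1)(n_2,h_2) = (n_1 \phi(h_1)(n_2),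 h_1 h_2)$; the set $D$ is regarded as a subset of this underlying set $G_1 \times G_2$. -}

module Defs where

open import Level using (0ℓ)
open import Data.Nat using (ℕ; zero; suc; _+_; _*_; _^_)
open import Data.Bool using (Bool; true; false; if_then_else_; _∧_; _∨_; not)
open import Data.Fin using (Fin; zero; suc; remQuot)
import Data.Fin as Fin
open import Data.Fin.Properties using (*↔×)
open import Data.Integer using (ℤ; +_; _-_; -_)
import Data.Integer as ℤ
open import Data.Integer.DivMod using (_/_)
open import Data.Product using (Σ; ∃; _×_; _,_; proj₁; proj₂)
open import Data.Sum using (_⊎_)
open import Data.List using (List; []; _∷_)
open import Data.Vec using (Vec; lookup)
open import Function using (_∘_; id)
open import Function.Bundles using (_↔_; Inverse; _⇔_)
open import Function.Definitions using (Bijective)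
open import Function.Properties.Inverse using (↔-trans)
open import Data.Product.Function.NonDependent.Propositional using (_×-↔_)
open import Relation.Binary.PropositionalEquality using (_≡_; refl; sym; trans; cong)
open import Relation.Nullary using (Dec; yes; no; ¬_)
open import Algebra.Structures using (IsGroup)

record FinOps : Set₁ where
  field
    Carrier : Set
    _∙_     : Carrier → Carrier → Carrier
    ε       : Carrier
    _⁻¹     : Carrier → Carrier
    order   : ℕ
    enum    : Fin order ↔ Carrier

  elt : Fin order → Carrier
  elt = Inverse.to enum

  index : Carrier → Fin order
  index = Inverse.from enum

  _≟_ : (x y : Carrier) → Dec (x ≡ y)
  x ≟ y with index x Fin.≟ index y
  ... | yes p = yes (trans (sym (Inverse.strictlyInverseˡ enum x))
                      (trans (cong elt p) (Inverse.strictlyInverseˡ enum y)))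
  ... | no ¬p = no (λ e → ¬p (cong index e))

  _==_ : Carrier → Carrier → Bool
  x == y with x ≟ y
  ... | yes _ = true
  ... | no  _ = false

record FinGroup : Set₁ where
  field
    ops     : FinOps
  open FinOps ops public
  field
    isGroup : IsGroup _≡_ _∙_ ε _⁻¹

count : ∀ {n} → (Fin n → Bool) → ℕ
count {zero}  f = 0
count {suc n} f = (if f zero then 1 else 0) + count (f ∘ suc)

Subset : FinOps → Set
Subset G = FinOps.Carrier G → Bool

size : (G : FinOps) → Subset G → ℕ
size G D = count (D ∘ FinOps.elt G)

complement : (G : FinOps) → Subset G → Subset G
complement G D = not ∘ D

diffCount : (G : FinOps) → Subset G → FinOps.Carrier G → ℕ
diffCount G D g =
  count (λ (p : Fin (order * order)) →
    let i = proj₁ (remQuot {order} order p) ; j = proj₂ (remQuot {order} order p)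
        d₁ = elt i ; d₂ = elt j
    in D d₁ ∧ D d₂ ∧ ((d₁ ∙ (d₂ ⁻¹)) == g))
  where open FinOps G

IsDifferenceSet : (G : FinOps) → ℕ → ℕ → ℕ → Subset G → Set
IsDifferenceSet G v k lam D =
  (FinOps.order G ≡ v) × (size G D ≡ k) ×
  (∀ g → ¬ (g ≡ FinOps.ε G) → diffCount G D g ≡ lam)

IsDifferenceSet′ : (G : FinOps) → Subset G → Set
IsDifferenceSet′ G D = Σ ℕ λ v → Σ ℕ λ k → Σ ℕ λ l → IsDifferenceSet G v k l D

Matrix : ℕ → ℕ → Set
Matrix m n = Fin m → Fin n → ℤ

-- Kronecker product A ⊗ B, row/column index of the product being
-- combine i k ↔ (i , k) (i.e. block (i,j) of A ⊗ B is A i j · B)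
_⊗_ : ∀ {m n p q} → Matrix m n → Matrix p q → Matrix (m * p) (n * q)
_⊗_ {m} {n} {p} {q} A B r c =
  A (proj₁ (remQuot {m} p r)) (proj₁ (remQuot {n} q c)) ℤ.*
  B (proj₂ (remQuot {m} p r)) (proj₂ (remQuot {n} q c))

I₄ : Matrix 4 4
I₄ i j with i Fin.≟ j
... | yes _ = + 1
... | no  _ = + 0

J : ∀ {m n} → Matrix m n
J _ _ = + 1

K₄ : Matrix 4 4
K₄ i j = + 1 - (+ 2 ℤ.* I₄ i j)

⊗pow : Matrix 4 4 → (m : ℕ) → Matrix (4 ^ m) (4 ^ m)
⊗pow M zero    _ _ = + 1
⊗pow M (suc m) = M ⊗ ⊗pow M m

symplecticMatrix : (m : ℕ) → Matrix (4 ^ m) (4 ^ m)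
symplecticMatrix m i j = (- (⊗pow K₄ m i j - J i j)) / (+ 2)

-- Development of a subset: points = elements x, blocks = translates gD;
-- incidence (x , gD) is 1 iff x ∈ gD, i.e. g⁻¹x ∈ D.

development : (G : FinOps) → Subset G →
  FinOps.Carrier G → FinOps.Carrier G → ℤ
development G D x g = if D ((g ⁻¹) ∙ x) then + 1 else + 0
  where open FinOps G

-- Isomorphism with an incidence matrix A (= P A₂ Q for permutation
-- matrices P, Q): bijections of the points and of the blocks with the
-- row / column indices of A preserving all incidences.
DevIsomorphicTo : (G : FinOps) → Subset G → ∀ {n} → Matrix n n → Set
DevIsomorphicTo G D {n} A =
  Σ (Fin n ↔ FinOps.Carrier G) λ π → Σ (Fin n ↔ FinOps.Carrier G) λ ρ →
    ∀ i j → development G D (Inverse.to π i) (Inverse.to ρ j) ≡ A i j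

IsSymplecticDifferenceSet : (G : FinOps) → Subset G → Set
IsSymplecticDifferenceSet G D =
  IsDifferenceSet′ G D ×
  Σ ℕ λ m → DevIsomorphicTo G D (symplecticMatrix m)

OrderEvenPowerOf2 : FinGroup → Set
OrderEvenPowerOf2 G = Σ ℕ λ m → FinGroup.order G ≡ 2 ^ (2 * m)

data Generated (G : FinGroup) {n : ℕ} (xs : Vec (FinGroup.Carrier G) n)
     : FinGroup.Carrier G → Set where
  gen-ε   : Generated G xs (FinGroup.ε G)
  gen-x   : ∀ i → Generated G xs (lookup xs i)
  gen-inv : ∀ {g} → Generated G xs g → Generated G xs (FinGroup._⁻¹ G g)
  gen-mul : ∀ {g h} → Generated G xs g → Generated G xs h →
            Generated G xs (FinGroup._∙_ G g h)

GeneratedBy : (G : FinGroup) → ∀ {n} → Vec (FinGroup.Carrier G) n → Set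
GeneratedBy G xs = ∀ g → Generated G xs g

IsAutomorphism : (G : FinGroup) → (FinGroup.Carrier G → FinGroup.Carrier G) → Set
IsAutomorphism G f =
  (∀ a b → f (a ∙ b) ≡ f a ∙ f b) × Bijective _≡_ _≡_ f
  where open FinGroup G

record AutHom (G₂ G₁ : FinGroup) : Set where
  field
    φ      : FinGroup.Carrier G₂ → FinGroup.Carrier G₁ → FinGroup.Carrier G₁
    φ-aut  : ∀ g → IsAutomorphism G₁ (φ g)
    φ-hom  : ∀ g h a → φ (FinGroup._∙_ G₂ g h) a ≡ φ g (φ h a)

ImageEq : (G : FinGroup) → (FinGroup.Carrier G → FinGroup.Carrier G) →
          Subset (FinGroup.ops G) → Set
ImageEq G f D = ∀ y → (Σ (FinGroup.Carrier G) λ d → (D d ≡ true) × (f d ≡ y)) ⇔ (D y ≡ true)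

semidirect : (G₁ G₂ : FinGroup) → AutHom G₂ G₁ → FinOps
semidirect G₁ G₂ Φ = record
  { Carrier = G₁.Carrier × G₂.Carrier
  ; _∙_     = λ { (n₁ , h₁) (n₂ , h₂) → (n₁ G₁.∙ φ h₁ n₂ , h₁ G₂.∙ h₂) }
  ; ε       = (G₁.ε , G₂.ε)
  ; _⁻¹     = λ { (n , h) → (φ (h G₂.⁻¹) (n G₁.⁻¹) , h G₂.⁻¹) }
  ; order   = G₁.order * G₂.order
  ; enum    = ↔-trans *↔× (G₁.enum ×-↔ G₂.enum)
  }
  where
    module G₁ = FinGroup G₁
    module G₂ = FinGroup G₂
    open AutHom Φ

productSet : (G₁ G₂ : FinGroup) → (Φ : AutHom G₂ G₁) →
  Subset (FinGroup.ops G₁) → Subset (FinGroup.ops G₂) →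
  Subset (semidirect G₁ G₂ Φ)
productSet G₁ G₂ Φ D₁ D₂ (a , b) =
  (D₁ a ∧ complement (FinGroup.ops G₂) D₂ b) ∨
  (complement (FinGroup.ops G₁) D₁ a ∧ D₂ b)

{-# OPTIONS --safe #-}
-- Read the 4^m points and blocks of the symplectic design as strings of m base-4 digits.  Then
-- r is incident with c iff the number of digits at which they agree is odd, and J − 2A is the
-- Kronecker power (J₄ − 2I₄)^⊗m: a Hadamard matrix all of whose columns sum to 2^m.  Since
-- 4[x ∧ y] = (1 − sign x)(1 − sign y) for Booleans, summing over the points shows that two distinct
-- blocks share exactly (4^m − 2·2^m)/4 points.  As diffCount g = |D ∩ gD|, any set with a symplectic development is a
-- difference set, so it suffices to show that the development of D is symplectic.
--
-- Since φ_{x_i} fixes D₁, so does every φ_h.  In G₁ ⋊ G₂ we have (n,h)⁻¹(a,b) = (φ_{h⁻¹}(n⁻¹a), h⁻¹b),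
-- so (a,b) ∈ (n,h)D iff exactly one of n⁻¹a ∈ D₁, h⁻¹b ∈ D₂ holds.  Splitting m₁ + m₂ digits into
-- the first m₁ and the last m₂, the parity of agreements is the xor of the two parities, so the
-- product of the two design isomorphisms is an isomorphism onto the symplectic design on 4^(m₁+m₂)
-- points.
module Submission where

open import Defs
open import Data.Nat using (ℕ)
open import Data.Vec using (Vec; lookup)

open import Algebra.Bundles using (Semiring; Group)
open import Algebra.Structures using (IsGroup)
import Algebra.Properties.Group as GroupProperties
import Algebra.Properties.Semiring.Sum as SemiringSum
open import Data.Bool using (Bool; true; false; _∧_; _∨_; not; _xor_; if_then_else_)
import Data.Bool.Properties as BoolP
open import Data.Empty using (⊥-elim)
open import Data.Fin as Fin using (Fin; zero; suc; remQuot; combine; _↑ˡ_; _↑ʳ_)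
import Data.Fin.Properties as FinP
import Data.Integer as ℤ
import Data.Integer.Properties as ℤP
open import Algebra.Properties.CommutativeSemigroup ℤP.*-commutativeSemigroup using (interchange)
import Data.Nat as ℕ
open import Data.Nat using (zero; suc; _^_; _∸_)
open import Data.Nat.DivMod using (_/_; m*n/n≡m)
import Data.Nat.Properties as ℕP
open import Data.Product using (_×_; _,_; proj₁; proj₂; uncurry)
open import Data.Product.Function.NonDependent.Propositional using (_×-↔_)
open import Function using (_∘_)
open import Function.Bundles using (_↔_; Inverse; mk↔ₛ′; mk⇔; Equivalence)
open import Function.Definitions using (Injective)
open import Function.Properties.Inverse using (↔-trans; ↔-sym)
open import Relation.Binary.PropositionalEquality
open import Relation.Nullary using (yes; no)
open import Relation.Nullary.Decidable using (isYes)

module FinSum {c ℓ} (R : Semiring c ℓ) where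
  open Semiring R
    using (Carrier; _≈_; _+_; _*_; 0#; +-congˡ; +-congʳ; +-assoc; +-identityˡ; +-identityʳ)
  open SemiringSum R
  module ≈ = Semiring R using (refl; sym; trans; reflexive)
  open import Relation.Binary.Reasoning.Setoid (Semiring.setoid R)

  sum-↑ : ∀ m n (f : Fin (m ℕ.+ n) → Carrier) →
          sum f ≈ sum (λ i → f (i ↑ˡ n)) + sum (λ j → f (m ↑ʳ j))
  sum-↑ zero    n f = ≈.sym (+-identityˡ _)
  sum-↑ (suc m) n f = ≈.trans (+-congˡ (sum-↑ m n (f ∘ suc))) (≈.sym (+-assoc _ _ _))

  sum-combine : ∀ m n (f : Fin (m ℕ.* n) → Carrier) →
                sum f ≈ sum (λ i → sum (λ j → f (combine {m} {n} i j)))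
  sum-combine zero    n f = ≈.refl
  sum-combine (suc m) n f =
    ≈.trans (sum-↑ n (m ℕ.* n) f) (+-congˡ (sum-combine m n (λ k → f (n ↑ʳ k))))

  sum-remQuot : ∀ m n (f : Fin m → Fin n → Carrier) →
                sum {m ℕ.* n} (uncurry f ∘ remQuot n) ≈ sum (λ i → sum (f i))
  sum-remQuot m n f = ≈.trans (sum-combine m n _) (≈.reflexive
    (sum-cong-≗ λ i → sum-cong-≗ λ j → cong (uncurry f) (FinP.remQuot-combine i j)))

  sum-remQuot-* : ∀ m n (x : Fin m → Carrier) (y : Fin n → Carrier) →
                  sum {m ℕ.* n} (uncurry (λ i j → x i * y j) ∘ remQuot n) ≈ sum x * sum y
  sum-remQuot-* m n x y = begin
    sum {m ℕ.* n} (uncurry (λ i j → x i * y j) ∘ remQuot n)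
      ≈⟨ sum-remQuot m n _ ⟩
    sum (λ i → sum (λ j → x i * y j))
      ≈⟨ sum-cong-≋ (λ i → ≈.sym (*-distribˡ-sum (x i) y)) ⟩
    sum (λ i → x i * sum y)
      ≈⟨ ≈.sym (*-distribʳ-sum (sum y) x) ⟩
    sum x * sum y ∎

  sum-zero : ∀ {n} (f : Fin n → Carrier) → (∀ i → f i ≈ 0#) → sum f ≈ 0#
  sum-zero {n} f f≈0 = ≈.trans (sum-cong-≋ f≈0) (sum-replicate-zero n)

  sum-δ : ∀ {n} (f : Fin n → Carrier) j → (∀ i → i ≢ j → f i ≈ 0#) → sum f ≈ f j
  sum-δ f zero    f≈0 =
    ≈.trans (+-congˡ (sum-zero (f ∘ suc) (λ i → f≈0 (suc i) λ ()))) (+-identityʳ _)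
  sum-δ f (suc j) f≈0 =
    ≈.trans (+-congʳ (f≈0 zero λ ())) (≈.trans (+-identityˡ _)
      (sum-δ (f ∘ suc) j (λ i i≢j → f≈0 (suc i) (i≢j ∘ FinP.suc-injective))))

open ℤ using (ℤ; +_; -[1+_]; _+_; _*_)
open SemiringSum ℤP.+-*-semiring using (sum; sum-cong-≗; ∑-distrib-+; sum-permute; *-distribˡ-sum)
open FinSum ℤP.+-*-semiring

sum-ones : ∀ n → sum {n} (λ _ → + 1) ≡ + n
sum-ones zero    = refl
sum-ones (suc n) = trans (cong (λ s → + 1 + s) (sum-ones n)) (sym (ℤP.pos-+ 1 n))

indicator : Bool → ℤ
indicator b = if b then + 1 else + 0

indicator-injective : ∀ a b → indicator a ≡ indicator b → a ≡ b
indicator-injective true  true  _ = refl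
indicator-injective false false _ = refl

count≡sum-indicator : ∀ {n} (f : Fin n → Bool) → + count f ≡ sum (indicator ∘ f)
count≡sum-indicator {zero}  f = refl
count≡sum-indicator {suc n} f = trans (ℤP.pos-+ _ (count (f ∘ suc)))
  (cong₂ _+_ (pos-if (f zero)) (count≡sum-indicator (f ∘ suc)))
  where
  pos-if : ∀ b → + (if b then 1 else 0) ≡ indicator b
  pos-if true  = refl
  pos-if false = refl

sign : Bool → ℤ
sign true  = -[1+ 0 ]
sign false = + 1

sign-xor : ∀ a b → sign a * sign b ≡ sign (a xor b)
sign-xor true  true  = refl
sign-xor true  false = refl
sign-xor false true  = refl
sign-xor false false = refl

-- 4·[a ∧ b] = (1 − sign a)(1 − sign b), rearranged.
indicator-∧-sign : ∀ a b → + 4 * indicator (a ∧ b) + sign a + sign b ≡ + 1 + sign a * sign b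
indicator-∧-sign true  true  = refl
indicator-∧-sign true  false = refl
indicator-∧-sign false true  = refl
indicator-∧-sign false false = refl

leadingDigit : ∀ m → Fin (4 ^ suc m) → Fin 4
leadingDigit m r = proj₁ (remQuot {4} (4 ^ m) r)

otherDigits : ∀ m → Fin (4 ^ suc m) → Fin (4 ^ m)
otherDigits m r = proj₂ (remQuot {4} (4 ^ m) r)

consDigit : ∀ m → Fin 4 → Fin (4 ^ m) → Fin (4 ^ suc m)
consDigit m = combine {4} {4 ^ m}

digits-consDigit : ∀ m a r → remQuot {4} (4 ^ m) (consDigit m a r) ≡ (a , r)
digits-consDigit m = FinP.remQuot-combine

consDigit-digits : ∀ m r → consDigit m (leadingDigit m r) (otherDigits m r) ≡ r
consDigit-digits m = FinP.combine-remQuot {4} (4 ^ m)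

digits-injective : ∀ m {r r'} →
  leadingDigit m r ≡ leadingDigit m r' → otherDigits m r ≡ otherDigits m r' → r ≡ r'
digits-injective m {r} {r'} a≡a' b≡b' = begin
  r                                                  ≡⟨ consDigit-digits m r ⟨
  consDigit m (leadingDigit m r) (otherDigits m r)   ≡⟨ cong₂ (consDigit m) a≡a' b≡b' ⟩
  consDigit m (leadingDigit m r') (otherDigits m r') ≡⟨ consDigit-digits m r' ⟩
  r'                                                 ∎
  where open ≡-Reasoning

agree₄ : Fin 4 → Fin 4 → Bool
agree₄ i j = isYes (i Fin.≟ j)

symplecticBit : ∀ m → Fin (4 ^ m) → Fin (4 ^ m) → Bool
symplecticBit zero    _ _ = false
symplecticBit (suc m) r c =
  agree₄ (leadingDigit m r) (leadingDigit m c) xor symplecticBit m (otherDigits m r) (otherDigits m c)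

symplecticBit-consDigit : ∀ m a r a' r' →
  symplecticBit (suc m) (consDigit m a r) (consDigit m a' r') ≡ agree₄ a a' xor symplecticBit m r r'
symplecticBit-consDigit m a r a' r' = cong₂
  (λ (a , r) (a' , r') → agree₄ a a' xor symplecticBit m r r')
  (digits-consDigit m a r) (digits-consDigit m a' r')

K₄≡sign-agree₄ : ∀ i j → K₄ i j ≡ sign (agree₄ i j)
K₄≡sign-agree₄ i j with i Fin.≟ j
... | yes _ = refl
... | no  _ = refl

⊗pow-K₄≡sign : ∀ m r c → ⊗pow K₄ m r c ≡ sign (symplecticBit m r c)
⊗pow-K₄≡sign zero    r c = refl
⊗pow-K₄≡sign (suc m) r c = trans
  (cong₂ _*_ (K₄≡sign-agree₄ a a') (⊗pow-K₄≡sign m b b'))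
  (sign-xor (agree₄ a a') (symplecticBit m b b'))
  where
  a  = leadingDigit m r
  a' = leadingDigit m c
  b  = otherDigits m r
  b' = otherDigits m c

symplecticMatrix≡indicator : ∀ m r c → symplecticMatrix m r c ≡ indicator (symplecticBit m r c)
symplecticMatrix≡indicator m r c rewrite ⊗pow-K₄≡sign m r c with symplecticBit m r c
... | true  = refl
... | false = refl

column-sum₄ : ∀ c → sum (λ i → sign (agree₄ i c)) ≡ + 2
column-sum₄ zero                   = refl
column-sum₄ (suc zero)             = refl
column-sum₄ (suc (suc zero))       = refl
column-sum₄ (suc (suc (suc zero))) = refl

columns-orthogonal₄ : ∀ c c' → c ≢ c' → sum (λ i → sign (agree₄ i c) * sign (agree₄ i c')) ≡ + 0
columns-orthogonal₄ zero                   zero                   c≢c' = ⊥-elim (c≢c' refl)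
columns-orthogonal₄ zero                   (suc zero)             _    = refl
columns-orthogonal₄ zero                   (suc (suc zero))       _    = refl
columns-orthogonal₄ zero                   (suc (suc (suc zero))) _    = refl
columns-orthogonal₄ (suc zero)             zero                   _    = refl
columns-orthogonal₄ (suc zero)             (suc zero)             c≢c' = ⊥-elim (c≢c' refl)
columns-orthogonal₄ (suc zero)             (suc (suc zero))       _    = refl
columns-orthogonal₄ (suc zero)             (suc (suc (suc zero))) _    = refl
columns-orthogonal₄ (suc (suc zero))       zero                   _    = refl
columns-orthogonal₄ (suc (suc zero))       (suc zero)             _    = refl
columns-orthogonal₄ (suc (suc zero))       (suc (suc zero))       c≢c' = ⊥-elim (c≢c' refl)
columns-orthogonal₄ (suc (suc zero))       (suc (suc (suc zero))) _    = refl
columns-orthogonal₄ (suc (suc (suc zero))) zero                   _    = refl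
columns-orthogonal₄ (suc (suc (suc zero))) (suc zero)             _    = refl
columns-orthogonal₄ (suc (suc (suc zero))) (suc (suc zero))       _    = refl
columns-orthogonal₄ (suc (suc (suc zero))) (suc (suc (suc zero))) c≢c' = ⊥-elim (c≢c' refl)

column-sum : ∀ m c → sum (λ r → sign (symplecticBit m r c)) ≡ + (2 ^ m)
column-sum zero    c = refl
column-sum (suc m) c = begin
  sum (λ r → sign (symplecticBit (suc m) r c))
    ≡⟨ sum-cong-≗ (λ r → sign-xor (agree₄ (leadingDigit m r) a) (symplecticBit m (otherDigits m r) b)) ⟨
  sum (λ r → x (leadingDigit m r) * y (otherDigits m r))
    ≡⟨ sum-remQuot-* 4 (4 ^ m) x y ⟩
  sum x * sum y
    ≡⟨ cong₂ _*_ (column-sum₄ a) (column-sum m b) ⟩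
  + 2 * + (2 ^ m)
    ≡⟨ ℤP.pos-* 2 (2 ^ m) ⟨
  + (2 ^ suc m) ∎
  where
  open ≡-Reasoning
  a = leadingDigit m c
  b = otherDigits m c
  x : Fin 4 → ℤ
  x i = sign (agree₄ i a)
  y : Fin (4 ^ m) → ℤ
  y j = sign (symplecticBit m j b)

columns-orthogonal : ∀ m {c c'} → c ≢ c' →
  sum (λ r → sign (symplecticBit m r c) * sign (symplecticBit m r c')) ≡ + 0
columns-orthogonal zero {zero} {zero} c≢c' = ⊥-elim (c≢c' refl)
columns-orthogonal (suc m) {c} {c'} c≢c' =
  trans (sum-cong-≗ factorise) (trans (sum-remQuot-* 4 (4 ^ m) x y) product≡0)
  where
  a  = leadingDigit m c
  a' = leadingDigit m c'
  b  = otherDigits m c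
  b' = otherDigits m c'
  S  = symplecticBit m
  x : Fin 4 → ℤ
  x i = sign (agree₄ i a) * sign (agree₄ i a')
  y : Fin (4 ^ m) → ℤ
  y j = sign (S j b) * sign (S j b')
  factorise : ∀ r → sign (symplecticBit (suc m) r c) * sign (symplecticBit (suc m) r c')
                    ≡ x (leadingDigit m r) * y (otherDigits m r)
  factorise r = trans
    (sym (cong₂ _*_ (sign-xor (agree₄ i a) (S j b)) (sign-xor (agree₄ i a') (S j b'))))
    (interchange (sign (agree₄ i a)) (sign (S j b)) (sign (agree₄ i a')) (sign (S j b')))
    where
    i = leadingDigit m r
    j = otherDigits m r
  product≡0 : sum x * sum y ≡ + 0
  product≡0 with a Fin.≟ a'
  ... | no  a≢a' = cong (_* sum y) (columns-orthogonal₄ a a' a≢a')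
  ... | yes a≡a' = trans (cong (sum x *_) (columns-orthogonal m (c≢c' ∘ digits-injective m a≡a')))
                         (ℤP.*-zeroʳ (sum x))

-- Sum indicator-∧-sign down two distinct columns: both ±1 columns sum to 2^m and they are orthogonal.
columns-meet-sum : ∀ m {c c'} → c ≢ c' →
  + 4 * sum (λ r → indicator (symplecticBit m r c ∧ symplecticBit m r c')) + + (2 ^ m) + + (2 ^ m)
  ≡ + (4 ^ m)
columns-meet-sum m {c} {c'} c≢c' = begin
  + 4 * sum I + + (2 ^ m) + + (2 ^ m)
    ≡⟨ cong₂ (λ u v → + 4 * sum I + u + v) (column-sum m c) (column-sum m c') ⟨
  + 4 * sum I + sum A + sum B
    ≡⟨ cong (λ u → u + sum A + sum B) (*-distribˡ-sum (+ 4) I) ⟩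
  sum (λ r → + 4 * I r) + sum A + sum B
    ≡⟨ cong (_+ sum B) (∑-distrib-+ (λ r → + 4 * I r) A) ⟨
  sum (λ r → + 4 * I r + A r) + sum B
    ≡⟨ ∑-distrib-+ (λ r → + 4 * I r + A r) B ⟨
  sum (λ r → + 4 * I r + A r + B r)
    ≡⟨ sum-cong-≗ (λ r → indicator-∧-sign (symplecticBit m r c) (symplecticBit m r c')) ⟩
  sum (λ r → + 1 + A r * B r)
    ≡⟨ ∑-distrib-+ {4 ^ m} (λ _ → + 1) (λ r → A r * B r) ⟩
  sum {4 ^ m} (λ _ → + 1) + sum (λ r → A r * B r)
    ≡⟨ cong₂ _+_ (sum-ones (4 ^ m)) (columns-orthogonal m c≢c') ⟩
  + (4 ^ m) + + 0
    ≡⟨ ℤP.+-identityʳ _ ⟩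
  + (4 ^ m) ∎
  where
  open ≡-Reasoning
  I A B : Fin (4 ^ m) → ℤ
  I r = indicator (symplecticBit m r c ∧ symplecticBit m r c')
  A r = sign (symplecticBit m r c)
  B r = sign (symplecticBit m r c')

pos-4*m+[k+k] : ∀ m k → + (4 ℕ.* m ℕ.+ (k ℕ.+ k)) ≡ + 4 * + m + + k + + k
pos-4*m+[k+k] m k = begin
  + (4 ℕ.* m ℕ.+ (k ℕ.+ k))  ≡⟨ cong +_ (ℕP.+-assoc (4 ℕ.* m) k k) ⟨
  + (4 ℕ.* m ℕ.+ k ℕ.+ k)    ≡⟨ ℤP.pos-+ (4 ℕ.* m ℕ.+ k) k ⟩
  + (4 ℕ.* m ℕ.+ k) + + k    ≡⟨ cong (_+ + k) (ℤP.pos-+ (4 ℕ.* m) k) ⟩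
  + (4 ℕ.* m) + + k + + k    ≡⟨ cong (λ z → z + + k + + k) (ℤP.pos-* 4 m) ⟩
  + 4 * + m + + k + + k      ∎
  where open ≡-Reasoning

4*m+k≡n⇒m≡[n∸k]/4 : ∀ {m k n} → 4 ℕ.* m ℕ.+ k ≡ n → m ≡ (n ∸ k) / 4
4*m+k≡n⇒m≡[n∸k]/4 {m} {k} refl = begin
  m                        ≡⟨ m*n/n≡m m 4 ⟨
  m ℕ.* 4 / 4              ≡⟨ cong (_/ 4) (ℕP.*-comm m 4) ⟩
  4 ℕ.* m / 4              ≡⟨ cong (_/ 4) (ℕP.m+n∸n≡m (4 ℕ.* m) k) ⟨
  (4 ℕ.* m ℕ.+ k ∸ k) / 4  ∎
  where open ≡-Reasoning

symplecticλ : ℕ → ℕ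
symplecticλ m = (4 ^ m ∸ (2 ^ m ℕ.+ 2 ^ m)) / 4

symplectic-columns-meet : ∀ m {c c'} → c ≢ c' →
  count (λ r → symplecticBit m r c ∧ symplecticBit m r c') ≡ symplecticλ m
symplectic-columns-meet m {c} {c'} c≢c' = 4*m+k≡n⇒m≡[n∸k]/4 (ℤP.+-injective (begin
  + (4 ℕ.* count I ℕ.+ (2 ^ m ℕ.+ 2 ^ m))
    ≡⟨ pos-4*m+[k+k] (count I) (2 ^ m) ⟩
  + 4 * + count I + + (2 ^ m) + + (2 ^ m)
    ≡⟨ cong (λ z → + 4 * z + + (2 ^ m) + + (2 ^ m)) (count≡sum-indicator I) ⟩
  + 4 * sum (indicator ∘ I) + + (2 ^ m) + + (2 ^ m)
    ≡⟨ columns-meet-sum m c≢c' ⟩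
  + (4 ^ m) ∎))
  where
  open ≡-Reasoning
  I : Fin (4 ^ m) → Bool
  I r = symplecticBit m r c ∧ symplecticBit m r c'

split : ∀ m₁ m₂ → Fin (4 ^ (m₁ ℕ.+ m₂)) → Fin (4 ^ m₁) × Fin (4 ^ m₂)
split zero     m₂ r = zero , r
split (suc m₁) m₂ r = consDigit m₁ (leadingDigit (m₁ ℕ.+ m₂) r) (proj₁ rest) , proj₂ rest
  where rest = split m₁ m₂ (otherDigits (m₁ ℕ.+ m₂) r)

join : ∀ m₁ m₂ → Fin (4 ^ m₁) × Fin (4 ^ m₂) → Fin (4 ^ (m₁ ℕ.+ m₂))
join zero     m₂ (_ , s) = s
join (suc m₁) m₂ (r , s) =
  consDigit (m₁ ℕ.+ m₂) (leadingDigit m₁ r) (join m₁ m₂ (otherDigits m₁ r , s))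

split-consDigit : ∀ m₁ m₂ a r → split (suc m₁) m₂ (consDigit (m₁ ℕ.+ m₂) a r)
                                ≡ (consDigit m₁ a (proj₁ (split m₁ m₂ r)) , proj₂ (split m₁ m₂ r))
split-consDigit m₁ m₂ a r = cong
  (λ (a , r) → consDigit m₁ a (proj₁ (split m₁ m₂ r)) , proj₂ (split m₁ m₂ r))
  (digits-consDigit (m₁ ℕ.+ m₂) a r)

join-consDigit : ∀ m₁ m₂ a r s →
  join (suc m₁) m₂ (consDigit m₁ a r , s) ≡ consDigit (m₁ ℕ.+ m₂) a (join m₁ m₂ (r , s))
join-consDigit m₁ m₂ a r s = cong
  (λ (a , r) → consDigit (m₁ ℕ.+ m₂) a (join m₁ m₂ (r , s)))
  (digits-consDigit m₁ a r)

split-join : ∀ m₁ m₂ rs → split m₁ m₂ (join m₁ m₂ rs) ≡ rs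
split-join zero     m₂ (zero , s) = refl
split-join (suc m₁) m₂ (r , s) = begin
  split (suc m₁) m₂ (consDigit (m₁ ℕ.+ m₂) a (join m₁ m₂ (b , s)))
    ≡⟨ split-consDigit m₁ m₂ a (join m₁ m₂ (b , s)) ⟩
  (consDigit m₁ a (proj₁ (split m₁ m₂ (join m₁ m₂ (b , s)))) , proj₂ (split m₁ m₂ (join m₁ m₂ (b , s))))
    ≡⟨ cong (λ (b , s) → consDigit m₁ a b , s) (split-join m₁ m₂ (b , s)) ⟩
  (consDigit m₁ a b , s)
    ≡⟨ cong (_, s) (consDigit-digits m₁ r) ⟩
  (r , s) ∎
  where
  open ≡-Reasoning
  a = leadingDigit m₁ r
  b = otherDigits m₁ r

join-split : ∀ m₁ m₂ r → join m₁ m₂ (split m₁ m₂ r) ≡ r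
join-split zero     m₂ r = refl
join-split (suc m₁) m₂ r = begin
  join (suc m₁) m₂ (split (suc m₁) m₂ r)
    ≡⟨ join-consDigit m₁ m₂ a (proj₁ (split m₁ m₂ rest)) (proj₂ (split m₁ m₂ rest)) ⟩
  consDigit (m₁ ℕ.+ m₂) a (join m₁ m₂ (split m₁ m₂ rest))
    ≡⟨ cong (consDigit (m₁ ℕ.+ m₂) a) (join-split m₁ m₂ rest) ⟩
  consDigit (m₁ ℕ.+ m₂) a rest
    ≡⟨ consDigit-digits (m₁ ℕ.+ m₂) r ⟩
  r ∎
  where
  open ≡-Reasoning
  a    = leadingDigit (m₁ ℕ.+ m₂) r
  rest = otherDigits (m₁ ℕ.+ m₂) r

split↔ : ∀ m₁ m₂ → Fin (4 ^ (m₁ ℕ.+ m₂)) ↔ (Fin (4 ^ m₁) × Fin (4 ^ m₂))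
split↔ m₁ m₂ = mk↔ₛ′ (split m₁ m₂) (join m₁ m₂) (split-join m₁ m₂) (join-split m₁ m₂)

symplecticBit-join : ∀ m₁ m₂ r₁ r₂ c₁ c₂ →
  symplecticBit (m₁ ℕ.+ m₂) (join m₁ m₂ (r₁ , r₂)) (join m₁ m₂ (c₁ , c₂))
  ≡ symplecticBit m₁ r₁ c₁ xor symplecticBit m₂ r₂ c₂
symplecticBit-join zero     m₂ r₁ r₂ c₁ c₂ = refl
symplecticBit-join (suc m₁) m₂ r₁ r₂ c₁ c₂ = begin
  symplecticBit (suc m₁ ℕ.+ m₂) (consDigit (m₁ ℕ.+ m₂) a (join m₁ m₂ (b , r₂)))
                                (consDigit (m₁ ℕ.+ m₂) a' (join m₁ m₂ (b' , c₂)))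
    ≡⟨ symplecticBit-consDigit (m₁ ℕ.+ m₂) a (join m₁ m₂ (b , r₂)) a' (join m₁ m₂ (b' , c₂)) ⟩
  agree₄ a a' xor symplecticBit (m₁ ℕ.+ m₂) (join m₁ m₂ (b , r₂)) (join m₁ m₂ (b' , c₂))
    ≡⟨ cong (agree₄ a a' xor_) (symplecticBit-join m₁ m₂ b r₂ b' c₂) ⟩
  agree₄ a a' xor (symplecticBit m₁ b b' xor symplecticBit m₂ r₂ c₂)
    ≡⟨ BoolP.xor-assoc (agree₄ a a') (symplecticBit m₁ b b') (symplecticBit m₂ r₂ c₂) ⟨
  (agree₄ a a' xor symplecticBit m₁ b b') xor symplecticBit m₂ r₂ c₂ ∎
  where
  open ≡-Reasoning
  a  = leadingDigit m₁ r₁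
  a' = leadingDigit m₁ c₁
  b  = otherDigits m₁ r₁
  b' = otherDigits m₁ c₁

symplecticBit-split : ∀ m₁ m₂ r c →
  symplecticBit (m₁ ℕ.+ m₂) r c
  ≡ symplecticBit m₁ (proj₁ (split m₁ m₂ r)) (proj₁ (split m₁ m₂ c))
    xor symplecticBit m₂ (proj₂ (split m₁ m₂ r)) (proj₂ (split m₁ m₂ c))
symplecticBit-split m₁ m₂ r c = trans
  (sym (cong₂ (symplecticBit (m₁ ℕ.+ m₂)) (join-split m₁ m₂ r) (join-split m₁ m₂ c)))
  (symplecticBit-join m₁ m₂ _ _ _ _)

module _ (G : FinOps) (D : Subset G) where
  open FinOps G

  symplectic-membership : ∀ m (π ρ : Fin (4 ^ m) ↔ Carrier) →
    (∀ r c → development G D (Inverse.to π r) (Inverse.to ρ c) ≡ symplecticMatrix m r c) →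
    ∀ r c → D ((Inverse.to ρ c ⁻¹) ∙ Inverse.to π r) ≡ symplecticBit m r c
  symplectic-membership m π ρ incidence r c =
    indicator-injective _ _ (trans (incidence r c) (symplecticMatrix≡indicator m r c))

module FinGroupProperties
  (G : FinOps) (isGroup : IsGroup _≡_ (FinOps._∙_ G) (FinOps.ε G) (FinOps._⁻¹ G)) where
  open FinOps G
  open IsGroup isGroup using (assoc; identityˡ; identityʳ; inverseˡ; inverseʳ)

  group : Group _ _
  group = record { isGroup = isGroup }

  open GroupProperties group using (ε⁻¹≈ε; ⁻¹-involutive; ⁻¹-anti-homo-∙)

  ==-true : ∀ {x y} → x ≡ y → (x == y) ≡ true
  ==-true {x} {y} x≡y with x ≟ y
  ... | yes _   = refl
  ... | no  x≢y = ⊥-elim (x≢y x≡y)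

  ==-false : ∀ {x y} → x ≢ y → (x == y) ≡ false
  ==-false {x} {y} x≢y with x ≟ y
  ... | yes x≡y = ⊥-elim (x≢y x≡y)
  ... | no  _   = refl

  x∙y⁻¹≡g⇒y≡g⁻¹∙x : ∀ x y g → x ∙ (y ⁻¹) ≡ g → y ≡ (g ⁻¹) ∙ x
  x∙y⁻¹≡g⇒y≡g⁻¹∙x x y g refl = sym (begin
    ((x ∙ (y ⁻¹)) ⁻¹) ∙ x       ≡⟨ cong (_∙ x) (⁻¹-anti-homo-∙ x (y ⁻¹)) ⟩
    (((y ⁻¹) ⁻¹) ∙ (x ⁻¹)) ∙ x  ≡⟨ assoc _ _ _ ⟩
    ((y ⁻¹) ⁻¹) ∙ ((x ⁻¹) ∙ x)  ≡⟨ cong (((y ⁻¹) ⁻¹) ∙_) (inverseˡ x) ⟩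
    ((y ⁻¹) ⁻¹) ∙ ε             ≡⟨ identityʳ _ ⟩
    (y ⁻¹) ⁻¹                   ≡⟨ ⁻¹-involutive y ⟩
    y                           ∎)
    where open ≡-Reasoning

  x∙[g⁻¹∙x]⁻¹≡g : ∀ x g → x ∙ (((g ⁻¹) ∙ x) ⁻¹) ≡ g
  x∙[g⁻¹∙x]⁻¹≡g x g = begin
    x ∙ (((g ⁻¹) ∙ x) ⁻¹)       ≡⟨ cong (x ∙_) (⁻¹-anti-homo-∙ (g ⁻¹) x) ⟩
    x ∙ ((x ⁻¹) ∙ ((g ⁻¹) ⁻¹))  ≡⟨ assoc _ _ _ ⟨
    (x ∙ (x ⁻¹)) ∙ ((g ⁻¹) ⁻¹)  ≡⟨ cong (_∙ ((g ⁻¹) ⁻¹)) (inverseʳ x) ⟩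
    ε ∙ ((g ⁻¹) ⁻¹)             ≡⟨ identityˡ _ ⟩
    (g ⁻¹) ⁻¹                   ≡⟨ ⁻¹-involutive g ⟩
    g                           ∎
    where open ≡-Reasoning

  ε⁻¹∙x≡x : ∀ x → (ε ⁻¹) ∙ x ≡ x
  ε⁻¹∙x≡x x = trans (cong (_∙ x) ε⁻¹≈ε) (identityˡ x)

  -- For each d₁ the only candidate partner is d₂ = g⁻¹ d₁.
  diffCount≡sum : ∀ D g → + diffCount G D g ≡ sum (λ i → indicator (D (elt i) ∧ D ((g ⁻¹) ∙ elt i)))
  diffCount≡sum D g = begin
    + diffCount G D g
      ≡⟨ count≡sum-indicator (uncurry pair ∘ remQuot order) ⟩
    sum (indicator ∘ uncurry pair ∘ remQuot order)
      ≡⟨ sum-remQuot order order (λ i j → indicator (pair i j)) ⟩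
    sum (λ i → sum (λ j → indicator (pair i j)))
      ≡⟨ sum-cong-≗ (λ i → sum-δ _ (partner i) (unmatched i)) ⟩
    sum (λ i → indicator (pair i (partner i)))
      ≡⟨ sum-cong-≗ matched ⟩
    sum (λ i → indicator (D (elt i) ∧ D ((g ⁻¹) ∙ elt i))) ∎
    where
    open ≡-Reasoning
    pair : Fin order → Fin order → Bool
    pair i j = D (elt i) ∧ D (elt j) ∧ ((elt i ∙ (elt j ⁻¹)) == g)
    partner : Fin order → Fin order
    partner i = index ((g ⁻¹) ∙ elt i)
    quotient≢g : ∀ i j → j ≢ partner i → elt i ∙ (elt j ⁻¹) ≢ g
    quotient≢g i j j≢partner = j≢partner ∘ trans (sym (Inverse.strictlyInverseʳ enum j))
                                         ∘ cong index ∘ x∙y⁻¹≡g⇒y≡g⁻¹∙x (elt i) (elt j) g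
    unmatched : ∀ i j → j ≢ partner i → indicator (pair i j) ≡ + 0
    unmatched i j j≢partner
      rewrite ==-false (quotient≢g i j j≢partner) | BoolP.∧-zeroʳ (D (elt j)) | BoolP.∧-zeroʳ (D (elt i))
      = refl
    matched : ∀ i → indicator (pair i (partner i)) ≡ indicator (D (elt i) ∧ D ((g ⁻¹) ∙ elt i))
    matched i
      rewrite Inverse.strictlyInverseˡ enum ((g ⁻¹) ∙ elt i) | ==-true (x∙[g⁻¹∙x]⁻¹≡g (elt i) g)
            | BoolP.∧-identityʳ (D ((g ⁻¹) ∙ elt i))
      = refl

  module SymplecticDevelopment (D : Subset G) (m : ℕ) (π ρ : Fin (4 ^ m) ↔ Carrier)
    (incidence : ∀ r c → development G D (Inverse.to π r) (Inverse.to ρ c) ≡ symplecticMatrix m r c)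
    where
    point : Fin (4 ^ m) → Carrier
    point = Inverse.to π

    block : Carrier → Fin (4 ^ m)
    block = Inverse.from ρ

    block-injective : ∀ {g h} → block g ≡ block h → g ≡ h
    block-injective {g} {h} e = trans (sym (Inverse.strictlyInverseˡ ρ g))
      (trans (cong (Inverse.to ρ) e) (Inverse.strictlyInverseˡ ρ h))

    ∈-translate : ∀ g k → D ((g ⁻¹) ∙ point k) ≡ symplecticBit m k (block g)
    ∈-translate g k = trans (cong (λ h → D ((h ⁻¹) ∙ point k)) (sym (Inverse.strictlyInverseˡ ρ g)))
                            (symplectic-membership G D m π ρ incidence k (block g))

    ∈-point : ∀ k → D (point k) ≡ symplecticBit m k (block ε)
    ∈-point k = trans (cong D (sym (ε⁻¹∙x≡x (point k)))) (∈-translate ε k)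

    diffCount≡blocks-meet : ∀ g →
      diffCount G D g ≡ count (λ k → symplecticBit m k (block ε) ∧ symplecticBit m k (block g))
    diffCount≡blocks-meet g = ℤP.+-injective (begin
      + diffCount G D g
        ≡⟨ diffCount≡sum D g ⟩
      sum (λ i → indicator (D (elt i) ∧ D ((g ⁻¹) ∙ elt i)))
        ≡⟨ sum-permute _ (↔-trans π (↔-sym enum)) ⟩
      sum (λ k → indicator (D (elt (index (point k))) ∧ D ((g ⁻¹) ∙ elt (index (point k)))))
        ≡⟨ sum-cong-≗ (λ k → cong (λ x → indicator (D x ∧ D ((g ⁻¹) ∙ x)))
                                  (Inverse.strictlyInverseˡ enum (point k))) ⟩
      sum (λ k → indicator (D (point k) ∧ D ((g ⁻¹) ∙ point k)))
        ≡⟨ sum-cong-≗ (λ k → cong₂ (λ a b → indicator (a ∧ b)) (∈-point k) (∈-translate g k)) ⟩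
      sum (indicator ∘ meet)
        ≡⟨ count≡sum-indicator meet ⟨
      + count meet ∎)
      where
      open ≡-Reasoning
      meet : Fin (4 ^ m) → Bool
      meet k = symplecticBit m k (block ε) ∧ symplecticBit m k (block g)

  symplectic⇒differenceSet : ∀ D m → DevIsomorphicTo G D (symplecticMatrix m) → IsDifferenceSet′ G D
  symplectic⇒differenceSet D m (π , ρ , incidence) =
    order , size G D , symplecticλ m , refl , refl , λ g g≢ε →
      trans (diffCount≡blocks-meet g) (symplectic-columns-meet m (g≢ε ∘ sym ∘ block-injective))
    where open SymplecticDevelopment D m π ρ incidence

disjointUnion≡xor : ∀ x y → (x ∧ not y) ∨ (not x ∧ y) ≡ x xor y
disjointUnion≡xor true  y = BoolP.∨-identityʳ (not y)
disjointUnion≡xor false y = refl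

imageEq⇒preserved : (G : FinGroup) (f : FinGroup.Carrier G → FinGroup.Carrier G)
  (D : Subset (FinGroup.ops G)) → Injective _≡_ _≡_ f → ImageEq G f D → ∀ z → D (f z) ≡ D z
imageEq⇒preserved G f D f-injective f[D]≡D z = BoolP.⇔→≡ {z = true} (mk⇔ ⊆D ⊇D)
  where
  ⊆D : D (f z) ≡ true → D z ≡ true
  ⊆D fz∈D with Equivalence.from (f[D]≡D (f z)) fz∈D
  ... | d , d∈D , fd≡fz = subst (λ x → D x ≡ true) (f-injective fd≡fz) d∈D
  ⊇D : D z ≡ true → D (f z) ≡ true
  ⊇D z∈D = Equivalence.to (f[D]≡D (f z)) (z , z∈D , refl)

module Semidirect (G₁ G₂ : FinGroup) (Φ : AutHom G₂ G₁) where
  private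
    module G₁ = FinGroup G₁
    module G₂ = FinGroup G₂
    module I₁ = IsGroup G₁.isGroup
    module I₂ = IsGroup G₂.isGroup
  open FinGroup G₁ using () renaming (_∙_ to _∙₁_; ε to ε₁; _⁻¹ to _⁻¹₁)
  open FinGroup G₂ using () renaming (_∙_ to _∙₂_; ε to ε₂; _⁻¹ to _⁻¹₂)
  open FinOps (semidirect G₁ G₂ Φ) using () renaming (_∙_ to _·_; _⁻¹ to _⁻¹ᴾ)
  open AutHom Φ
  open GroupProperties (FinGroupProperties.group G₁.ops G₁.isGroup) using (identityˡ-unique)

  φ-∙ : ∀ h a b → φ h (a ∙₁ b) ≡ φ h a ∙₁ φ h b
  φ-∙ h = proj₁ (φ-aut h)

  φ-injective : ∀ h → Injective _≡_ _≡_ (φ h)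
  φ-injective h = proj₁ (proj₂ (φ-aut h))

  φ-ε : ∀ h → φ h ε₁ ≡ ε₁
  φ-ε h = identityˡ-unique (φ h ε₁) (φ h ε₁) (trans (sym (φ-∙ h ε₁ ε₁)) (cong (φ h) (I₁.identityˡ ε₁)))

  φ-identity : ∀ a → φ ε₂ a ≡ a
  φ-identity a = φ-injective ε₂ (trans (sym (φ-hom ε₂ ε₂ a)) (cong (λ g → φ g a) (I₂.identityˡ ε₂)))

  semidirect-isGroup : IsGroup _≡_ _·_ (ε₁ , ε₂) _⁻¹ᴾ
  semidirect-isGroup = record
    { isMonoid = record
      { isSemigroup = record
        { isMagma = record { isEquivalence = isEquivalence ; ∙-cong = cong₂ _·_ }
        ; assoc   = assoc }
      ; identity = identityˡ , identityʳ }
    ; inverse = inverseˡ , inverseʳ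
    ; ⁻¹-cong = cong _⁻¹ᴾ }
    where
    open ≡-Reasoning
    assoc : ∀ x y z → (x · y) · z ≡ x · (y · z)
    assoc (a , b) (c , d) (e , f) = cong₂ _,_ (begin
      (a ∙₁ φ b c) ∙₁ φ (b ∙₂ d) e   ≡⟨ I₁.assoc _ _ _ ⟩
      a ∙₁ (φ b c ∙₁ φ (b ∙₂ d) e)   ≡⟨ cong (λ z → a ∙₁ (φ b c ∙₁ z)) (φ-hom b d e) ⟩
      a ∙₁ (φ b c ∙₁ φ b (φ d e))    ≡⟨ cong (a ∙₁_) (φ-∙ b c (φ d e)) ⟨
      a ∙₁ φ b (c ∙₁ φ d e)          ∎) (I₂.assoc b d f)
    identityˡ : ∀ x → (ε₁ , ε₂) · x ≡ x
    identityˡ (a , b) = cong₂ _,_ (trans (I₁.identityˡ _) (φ-identity a)) (I₂.identityˡ b)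
    identityʳ : ∀ x → x · (ε₁ , ε₂) ≡ x
    identityʳ (a , b) = cong₂ _,_ (trans (cong (a ∙₁_) (φ-ε b)) (I₁.identityʳ a)) (I₂.identityʳ b)
    inverseˡ : ∀ x → (x ⁻¹ᴾ) · x ≡ (ε₁ , ε₂)
    inverseˡ (a , b) = cong₂ _,_ (begin
      φ (b ⁻¹₂) (a ⁻¹₁) ∙₁ φ (b ⁻¹₂) a  ≡⟨ φ-∙ (b ⁻¹₂) (a ⁻¹₁) a ⟨
      φ (b ⁻¹₂) ((a ⁻¹₁) ∙₁ a)          ≡⟨ cong (φ (b ⁻¹₂)) (I₁.inverseˡ a) ⟩
      φ (b ⁻¹₂) ε₁                      ≡⟨ φ-ε (b ⁻¹₂) ⟩
      ε₁                                ∎) (I₂.inverseˡ b)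
    inverseʳ : ∀ x → x · (x ⁻¹ᴾ) ≡ (ε₁ , ε₂)
    inverseʳ (a , b) = cong₂ _,_ (begin
      a ∙₁ φ b (φ (b ⁻¹₂) (a ⁻¹₁))      ≡⟨ cong (a ∙₁_) (φ-hom b (b ⁻¹₂) (a ⁻¹₁)) ⟨
      a ∙₁ φ (b ∙₂ (b ⁻¹₂)) (a ⁻¹₁)     ≡⟨ cong (λ g → a ∙₁ φ g (a ⁻¹₁)) (I₂.inverseʳ b) ⟩
      a ∙₁ φ ε₂ (a ⁻¹₁)                 ≡⟨ cong (a ∙₁_) (φ-identity (a ⁻¹₁)) ⟩
      a ∙₁ (a ⁻¹₁)                      ≡⟨ I₁.inverseʳ a ⟩
      ε₁                                ∎) (I₂.inverseʳ b)

  Invariant : Subset G₁.ops → Set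
  Invariant D₁ = ∀ h z → D₁ (φ h z) ≡ D₁ z

  generated-invariant : (D₁ : Subset G₁.ops) {n : ℕ} (xs : Vec G₂.Carrier n) →
    (∀ i → ImageEq G₁ (φ (lookup xs i)) D₁) →
    ∀ {g} → Generated G₂ xs g → ∀ z → D₁ (φ g z) ≡ D₁ z
  generated-invariant D₁ xs φxs[D₁]≡D₁ = go
    where
    go : ∀ {g} → Generated G₂ xs g → ∀ z → D₁ (φ g z) ≡ D₁ z
    go gen-ε z = cong D₁ (φ-identity z)
    go (gen-x i) z =
      imageEq⇒preserved G₁ (φ (lookup xs i)) D₁ (φ-injective (lookup xs i)) (φxs[D₁]≡D₁ i) z
    go (gen-inv {g} g∈) z = begin
      D₁ (φ (g ⁻¹₂) z)            ≡⟨ go g∈ _ ⟨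
      D₁ (φ g (φ (g ⁻¹₂) z))      ≡⟨ cong D₁ (φ-hom g (g ⁻¹₂) z) ⟨
      D₁ (φ (g ∙₂ (g ⁻¹₂)) z)     ≡⟨ cong (λ h → D₁ (φ h z)) (I₂.inverseʳ g) ⟩
      D₁ (φ ε₂ z)                 ≡⟨ cong D₁ (φ-identity z) ⟩
      D₁ z                        ∎
      where open ≡-Reasoning
    go (gen-mul {g} {h} g∈ h∈) z = trans (cong D₁ (φ-hom g h z)) (trans (go g∈ _) (go h∈ z))

  -- (n , h)⁻¹ · (a , b) = (φ (h⁻¹) (n⁻¹ a) , h⁻¹ b).
  productSet-translate : ∀ {D₁ D₂} → Invariant D₁ → ∀ n h a b →
    productSet G₁ G₂ Φ D₁ D₂ (((n , h) ⁻¹ᴾ) · (a , b)) ≡ D₁ ((n ⁻¹₁) ∙₁ a) xor D₂ ((h ⁻¹₂) ∙₂ b)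
  productSet-translate {D₁} {D₂} invariant n h a b = begin
    productSet G₁ G₂ Φ D₁ D₂ (((n , h) ⁻¹ᴾ) · (a , b))
      ≡⟨ disjointUnion≡xor (D₁ (φ (h ⁻¹₂) (n ⁻¹₁) ∙₁ φ (h ⁻¹₂) a)) (D₂ ((h ⁻¹₂) ∙₂ b)) ⟩
    D₁ (φ (h ⁻¹₂) (n ⁻¹₁) ∙₁ φ (h ⁻¹₂) a) xor D₂ ((h ⁻¹₂) ∙₂ b)
      ≡⟨ cong (λ x → D₁ x xor D₂ ((h ⁻¹₂) ∙₂ b)) (φ-∙ (h ⁻¹₂) (n ⁻¹₁) a) ⟨
    D₁ (φ (h ⁻¹₂) ((n ⁻¹₁) ∙₁ a)) xor D₂ ((h ⁻¹₂) ∙₂ b)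
      ≡⟨ cong (_xor D₂ ((h ⁻¹₂) ∙₂ b)) (invariant (h ⁻¹₂) ((n ⁻¹₁) ∙₁ a)) ⟩
    D₁ ((n ⁻¹₁) ∙₁ a) xor D₂ ((h ⁻¹₂) ∙₂ b) ∎
    where open ≡-Reasoning

  productSet-symplectic : ∀ {D₁ D₂} → Invariant D₁ → ∀ {m₁ m₂} →
    DevIsomorphicTo G₁.ops D₁ (symplecticMatrix m₁) →
    DevIsomorphicTo G₂.ops D₂ (symplecticMatrix m₂) →
    DevIsomorphicTo (semidirect G₁ G₂ Φ) (productSet G₁ G₂ Φ D₁ D₂) (symplecticMatrix (m₁ ℕ.+ m₂))
  productSet-symplectic {D₁} {D₂} invariant {m₁} {m₂} (π₁ , ρ₁ , incidence₁) (π₂ , ρ₂ , incidence₂) =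
    π , ρ , incidence
    where
    D : Subset (semidirect G₁ G₂ Φ)
    D = productSet G₁ G₂ Φ D₁ D₂
    π ρ : Fin (4 ^ (m₁ ℕ.+ m₂)) ↔ (G₁.Carrier × G₂.Carrier)
    π = ↔-trans (split↔ m₁ m₂) (π₁ ×-↔ π₂)
    ρ = ↔-trans (split↔ m₁ m₂) (ρ₁ ×-↔ ρ₂)
    incidence : ∀ r c → development (semidirect G₁ G₂ Φ) D (Inverse.to π r) (Inverse.to ρ c)
                        ≡ symplecticMatrix (m₁ ℕ.+ m₂) r c
    incidence r c = begin
      indicator (D (((n , h) ⁻¹ᴾ) · (a , b)))
        ≡⟨ cong indicator (productSet-translate {D₁} {D₂} invariant n h a b) ⟩
      indicator (D₁ ((n ⁻¹₁) ∙₁ a) xor D₂ ((h ⁻¹₂) ∙₂ b))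
        ≡⟨ cong indicator (cong₂ _xor_ (symplectic-membership G₁.ops D₁ m₁ π₁ ρ₁ incidence₁ r₁ c₁)
                                       (symplectic-membership G₂.ops D₂ m₂ π₂ ρ₂ incidence₂ r₂ c₂)) ⟩
      indicator (symplecticBit m₁ r₁ c₁ xor symplecticBit m₂ r₂ c₂)
        ≡⟨ cong indicator (symplecticBit-split m₁ m₂ r c) ⟨
      indicator (symplecticBit (m₁ ℕ.+ m₂) r c)
        ≡⟨ symplecticMatrix≡indicator (m₁ ℕ.+ m₂) r c ⟨
      symplecticMatrix (m₁ ℕ.+ m₂) r c ∎
      where
      open ≡-Reasoning
      r₁ = proj₁ (split m₁ m₂ r)
      r₂ = proj₂ (split m₁ m₂ r)
      c₁ = proj₁ (split m₁ m₂ c)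
      c₂ = proj₂ (split m₁ m₂ c)
      a = Inverse.to π₁ r₁
      b = Inverse.to π₂ r₂
      n = Inverse.to ρ₁ c₁
      h = Inverse.to ρ₂ c₂

theorem4p2 : (G₁ G₂ : FinGroup) →
    OrderEvenPowerOf2 G₁ → OrderEvenPowerOf2 G₂ →
    (n : ℕ) (xs : Vec (FinGroup.Carrier G₂) n) → GeneratedBy G₂ xs →
    (D₁ : Subset (FinGroup.ops G₁)) (D₂ : Subset (FinGroup.ops G₂)) →
    IsSymplecticDifferenceSet (FinGroup.ops G₁) D₁ →
    IsSymplecticDifferenceSet (FinGroup.ops G₂) D₂ →
    (Φ : AutHom G₂ G₁) →
    (∀ i → ImageEq G₁ (AutHom.φ Φ (lookup xs i)) D₁) →
    IsSymplecticDifferenceSet (semidirect G₁ G₂ Φ) (productSet G₁ G₂ Φ D₁ D₂)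
theorem4p2 G₁ G₂ _ _ _ xs generated D₁ D₂ (_ , m₁ , iso₁) (_ , m₂ , iso₂) Φ φxs[D₁]≡D₁ =
  symplectic⇒differenceSet D (m₁ ℕ.+ m₂) iso , m₁ ℕ.+ m₂ , iso
  where
  open Semidirect G₁ G₂ Φ
  open FinGroupProperties (semidirect G₁ G₂ Φ) semidirect-isGroup using (symplectic⇒differenceSet)
  D : Subset (semidirect G₁ G₂ Φ)
  D = productSet G₁ G₂ Φ D₁ D₂
  D₁-invariant : Invariant D₁
  D₁-invariant h = generated-invariant D₁ xs φxs[D₁]≡D₁ (generated h)
  iso : DevIsomorphicTo (semidirect G₁ G₂ Φ) D (symplecticMatrix (m₁ ℕ.+ m₂))
  iso = productSet-symplectic {D₁} {D₂} D₁-invariant {m₁} {m₂} iso₁ iso₂
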